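{- For every finite state space $\Omega$, common prior $\mathcal{D}$, pair of initial knowledge partitions, and $f:\Omega\to[0,1]$, and for all $\varepsilon,\delta>0$, the discretized protocol with parameter $\varepsilon$ causes Alice and Bob to $(\varepsilon,\delta)$-agree after $O(1/(\delta\varepsilon^2))$ messages, where the constant in the $O$ is absolute.
   Context: $\Omega$ is a finite set of states and $\mathcal{D}$ is a common prior with full support. Agent $i\in\{A,B\}$ (Alice, Bob) knows the set $\Omega_{i,t}(\omega)$ after $t$ messages; initially these are the blocks of the agents' initial partitions. Write $E_{i,t}(\omega)=\mathbb{E}_{\mathcal{D}}[f\mid\Omega_{i,t}(\omega)]$. Let $\Omega_{C,t}(\omega)$ be the set of states consistent with the first $t$ messages alone, with $\Omega_{C,0}=\Omega$. This is the knowledge of an observer "Charlie" who sees all messages but neither input. Let $E_{C,t}(\omega)=\mathbb{E}_{\mathcal{D}}[f\mid\Omega_{C,t}(\omega)]$. Discretized protocol: the agents alternate, Alice first. When it is agent $i$'s turn after $t$ messages, she sends - "high" if $E_{i,t}>E_{C,t}+\varepsilon/4$, - "low" if $E_{i,t}<E_{C,t}-\varepsilon/4$, - "medium" otherwise, which is a $2$-bit message. The receiver, and Charlie, intersect their current sets with the set of states at which the sender would have sent that same message. The agents $(\varepsilon,\delta)$-agree after the $t$-th message if $\Pr_{\omega\sim\mathcal{D}}[|E_{A,t}(\omega)-E_{B,t}(\omega)|>\varepsilon]\le\delta$.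
   Formalization: The common prior $\mathcal{D}$ and the function f take rational values, and the parameters ε and δ are rational rather than real. -}

module Defs where

open import Data.Bool using (Bool; true; false; if_then_else_; _∧_)
open import Data.Nat as ℕ using (ℕ; zero; suc; _≡ᵇ_)
open import Data.Fin using (Fin)
import Data.Fin as Fin
open import Data.Integer using (+_)
open import Data.Rational using (ℚ; 0ℚ; _+_; _*_; _-_; _<_; _/_; 1/_; ≢-nonZero; ∣_∣)
open import Data.Rational.Properties using (_≟_; _<?_)
open import Data.Product using (_×_; _,_; proj₁; proj₂)
open import Relation.Nullary using (yes; no; does)

Event : ℕ → Set
Event n = Fin n → Bool

Σ[Ω] : (n : ℕ) → (Fin n → ℚ) → ℚ
Σ[Ω] zero    g = 0ℚ
Σ[Ω] (suc n) g = g Fin.zero + Σ[Ω] n (λ i → g (Fin.suc i))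

Pr : (n : ℕ) → (D : Fin n → ℚ) → Event n → ℚ
Pr n D S = Σ[Ω] n (λ ω → if S ω then D ω else 0ℚ)

-- Conditional expectation E_D[f | S] (defined as 0 on a null event; never
-- used on null events since D has full support and S contains the true state).
condExp : (n : ℕ) → (D f : Fin n → ℚ) → Event n → ℚ
condExp n D f S with Pr n D S ≟ 0ℚ
... | yes _ = 0ℚ
... | no  m≢0 = Σ[Ω] n (λ ω → if S ω then D ω * f ω else 0ℚ) * (1/_ (Pr n D S) {{≢-nonZero m≢0}})

-- A partition of Ω is given by a block label for each state; the block of ω
-- is the set of states with the same label.
Partition : ℕ → Set
Partition n = Fin n → ℕ

block : {n : ℕ} → Partition n → Fin n → Event n
block p ω ω' = p ω' ≡ᵇ p ω

data Msg : Set where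
  high low medium : Msg

_==ᴹ_ : Msg → Msg → Bool
high   ==ᴹ high   = true
low    ==ᴹ low    = true
medium ==ᴹ medium = true
_      ==ᴹ _      = false

quarter : ℚ
quarter = + 1 / 4

discMsg : (ε e eC : ℚ) → Msg
discMsg ε e eC with does (eC + ε * quarter <? e) | does (e <? eC - ε * quarter)
... | true  | _     = high
... | false | true  = low
... | false | false = medium

-- Knowledge after t messages, as a function of the true state ω:
-- (Alice's set Ω_{A,t}(ω), Bob's set Ω_{B,t}(ω), Charlie's set Ω_{C,t}(ω)).
Knowledge : ℕ → Set
Knowledge n = Fin n → Event n × Event n × Event n

knowA knowB knowC : {n : ℕ} → Knowledge n → Fin n → Event n
knowA K ω = proj₁ (K ω)
knowB K ω = proj₁ (proj₂ (K ω))
knowC K ω = proj₂ (proj₂ (K ω))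

aliceTurn : ℕ → Bool
aliceTurn zero          = true
aliceTurn (suc zero)    = false
aliceTurn (suc (suc t)) = aliceTurn t

module Protocol (n : ℕ) (D f : Fin n → ℚ) (pA pB : Partition n) (ε : ℚ) where

  E : Event n → ℚ
  E = condExp n D f

  mutual
    know : ℕ → Knowledge n
    know zero    ω = block pA ω , block pB ω , (λ _ → true)
    know (suc t) ω with aliceTurn t
    ... | true  = knowA (know t) ω
                , (λ ω' → knowB (know t) ω ω' ∧ (msg t ω' ==ᴹ msg t ω))
                , (λ ω' → knowC (know t) ω ω' ∧ (msg t ω' ==ᴹ msg t ω))
    ... | false = (λ ω' → knowA (know t) ω ω' ∧ (msg t ω' ==ᴹ msg t ω))
                , knowB (know t) ω
                , (λ ω' → knowC (know t) ω ω' ∧ (msg t ω' ==ᴹ msg t ω))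

    -- The (t+1)-st message, sent after t messages, at true state ω.
    msg : ℕ → Fin n → Msg
    msg t ω = discMsg ε (E (if aliceTurn t then knowA (know t) ω else knowB (know t) ω))
                        (E (knowC (know t) ω))

  EA EB : ℕ → Fin n → ℚ
  EA t ω = E (knowA (know t) ω)
  EB t ω = E (knowB (know t) ω)

  Agree : (δ : ℚ) → ℕ → Set
  Agree δ t = Pr n D (λ ω → does (ε <? ∣ EA t ω - EB t ω ∣)) Data.Rational.≤ δ

{-# OPTIONS --safe #-}

-- The potential is Charlie's second moment Φ t = 𝔼[E_{C,t}²], which lies in [0, 1]. Charlie's
-- partitions only get finer, so by Pythagoras Φ (t+1) - Φ t = 𝔼[(E_{C,t+1} - E_{C,t})²].
-- A "high"/"low" message tells Charlie that the sender's estimate exceeds (falls below) his own by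
-- ε/4, and since Charlie's new estimate and the sender's are equally correlated with the message,
-- completing the square shows that Φ grows by at least (ε/4)² Pr[the message is not "medium"].
-- If both messages of an Alice–Bob round are "medium" on a state where afterwards |E_A - E_B| > ε,
-- each agent is within ε/4 of Charlie's successive estimates there, so Charlie's estimate moved by
-- at least ε/4. Hence each round ending without (ε, δ)-agreement raises Φ by at least ε²δ/32, and
-- agreement is reached within 32/(δε²) rounds (at time 0 if δ ≥ 1 or ε ≥ 1).

module Submission where

open import Defs
open import Algebra.Bundles using (CommutativeRing)
open import Data.Bool using (Bool; true; false; T; if_then_else_; _∧_; not)
open import Data.Bool.Properties using (T-∧; T-≡)
open import Data.Fin as Fin using (Fin)
open import Data.Fin.Patterns using (0F)
open import Data.Integer as ℤ using (+_; +<+)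
import Data.Integer.Tactic.RingSolver as ℤ-Solver
open import Data.Nat as ℕ using (ℕ; zero; suc)
import Data.Nat.Properties as ℕ
open import Data.Product using (∃-syntax; _×_; _,_; proj₁; proj₂)
open import Data.Rational
  using (ℚ; 0ℚ; 1ℚ; ½; _+_; _*_; _-_; -_; _/_; 1/_; _≤_; _<_; ∣_∣; mkℚ; toℚᵘ;
         NonZero; Positive; positive; nonNegative; ≢-nonZero)
open import Data.Rational.Properties
open import Data.Rational.Solver using (module +-*-Solver)
open +-*-Solver using (solve; _:=_; _:+_; _:*_; _:-_; :-_; con)
open import Data.Rational.Unnormalised as ℚᵘ using (mkℚᵘ; *≡*; *<*)
import Data.Rational.Unnormalised.Properties as ℚᵘ
open import Data.Sum using (_⊎_; inj₁; inj₂)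
open import Function using (_∘_; _$_; Equivalence)
open import Relation.Binary.PropositionalEquality
open import Relation.Nullary using (Dec; yes; no; does; ¬_; contradiction)
open CommutativeRing +-*-commutativeRing using (semiring)
open import Algebra.Properties.Semiring.Sum semiring
  using (sum; sum-cong-≗; ∑-distrib-+; *-distribˡ-sum; ∑-comm)

p≤q⇒0≤q-p : ∀ {p q} → p ≤ q → 0ℚ ≤ q - p
p≤q⇒0≤q-p {p} {q} p≤q = subst (_≤ q - p) (+-inverseʳ p) (+-monoˡ-≤ (- p) p≤q)

≤-by-diff : ∀ {p q r} → q - p ≡ r → 0ℚ ≤ r → p ≤ q
≤-by-diff {p} {q} q-p≡r 0≤r =
  subst₂ _≤_ (+-identityˡ p) (q-p+p≡q p q) (+-monoˡ-≤ p (subst (0ℚ ≤_) (sym q-p≡r) 0≤r))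
  where
  q-p+p≡q : ∀ p q → q - p + p ≡ q
  q-p+p≡q = solve 2 (λ p q → q :- p :+ p := q) refl

0≤p*q : ∀ {p q} → 0ℚ ≤ p → 0ℚ ≤ q → 0ℚ ≤ p * q
0≤p*q {p} {q} 0≤p 0≤q =
  nonNegative⁻¹ (p * q) {{nonNeg*nonNeg⇒nonNeg p {{nonNegative 0≤p}} q {{nonNegative 0≤q}}}}

0≤p*p : ∀ p → 0ℚ ≤ p * p
0≤p*p p with ≤-total 0ℚ p
... | inj₁ 0≤p = 0≤p*q 0≤p 0≤p
... | inj₂ p≤0 = subst (0ℚ ≤_) (-p*-p≡p*p p) (0≤p*q 0≤-p 0≤-p)
  where
  0≤-p = neg-antimono-≤ p≤0
  -p*-p≡p*p : ∀ p → - p * - p ≡ p * p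
  -p*-p≡p*p = solve 1 (λ p → (:- p) :* (:- p) := p :* p) refl

p≤p+q : ∀ {p q} → 0ℚ ≤ q → p ≤ p + q
p≤p+q {p} {q} 0≤q = subst (_≤ p + q) (+-identityʳ p) (+-monoʳ-≤ p 0≤q)

q≤p+q : ∀ {p q} → 0ℚ ≤ p → q ≤ p + q
q≤p+q {p} {q} 0≤p = subst (_≤ p + q) (+-identityˡ q) (+-monoˡ-≤ q 0≤p)

∣p∣≤q : ∀ {p q} → - q ≤ p → p ≤ q → ∣ p ∣ ≤ q
∣p∣≤q {p} {q} -q≤p p≤q with ∣p∣≡p∨∣p∣≡-p p
... | inj₁ ∣p∣≡p  = subst (_≤ q) (sym ∣p∣≡p) p≤q
... | inj₂ ∣p∣≡-p = subst (_≤ q) (sym ∣p∣≡-p) (≤-by-diff (q-[-p]≡p-[-q] p q) (p≤q⇒0≤q-p -q≤p))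
  where
  q-[-p]≡p-[-q] : ∀ p q → q - (- p) ≡ p - (- q)
  q-[-p]≡p-[-q] = solve 2 (λ p q → q :- (:- p) := p :- (:- q)) refl

∣x-y-z∣≤∣x∣+∣y∣+∣z∣ : ∀ x y z → ∣ x - y - z ∣ ≤ ∣ x ∣ + ∣ y ∣ + ∣ z ∣
∣x-y-z∣≤∣x∣+∣y∣+∣z∣ x y z = ≤-trans (∣p-q∣≤∣p∣+∣q∣ (x - y) z) (+-monoˡ-≤ ∣ z ∣ (∣p-q∣≤∣p∣+∣q∣ x y))

0<p*q : ∀ {p q} → 0ℚ < p → 0ℚ < q → 0ℚ < p * q
0<p*q {p} {q} 0<p 0<q = positive⁻¹ (p * q) {{pos*pos⇒pos p {{positive 0<p}} q {{positive 0<q}}}}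

p*q≤1 : ∀ {p q} → 0ℚ ≤ p → p ≤ 1ℚ → 0ℚ ≤ q → q ≤ 1ℚ → p * q ≤ 1ℚ
p*q≤1 {p} {q} 0≤p p≤1 0≤q q≤1 = begin
  p * q   ≤⟨ *-monoˡ-≤-nonNeg p {{nonNegative 0≤p}} q≤1 ⟩
  p * 1ℚ  ≡⟨ *-identityʳ p ⟩
  p       ≤⟨ p≤1 ⟩
  1ℚ      ∎
  where open ≤-Reasoning

∣p-q∣≤1 : ∀ {p q} → 0ℚ ≤ p → p ≤ 1ℚ → 0ℚ ≤ q → q ≤ 1ℚ → ∣ p - q ∣ ≤ 1ℚ
∣p-q∣≤1 {p} {q} 0≤p p≤1 0≤q q≤1 =
  ∣p∣≤q (≤-by-diff (lower p q) (+-mono-≤ 0≤p (p≤q⇒0≤q-p q≤1)))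
        (≤-by-diff (upper p q) (+-mono-≤ (p≤q⇒0≤q-p p≤1) 0≤q))
  where
  lower : ∀ p q → (p - q) - - 1ℚ ≡ p + (1ℚ - q)
  lower = solve 2 (λ p q → (p :- q) :- (:- con 1ℚ) := p :+ (con 1ℚ :- q)) refl
  upper : ∀ p q → 1ℚ - (p - q) ≡ (1ℚ - p) + q
  upper = solve 2 (λ p q → con 1ℚ :- (p :- q) := (con 1ℚ :- p) :+ q) refl

a≤∣x∣⇒a*a≤x*x : ∀ {a x} → 0ℚ ≤ a → a ≤ ∣ x ∣ → a * a ≤ x * x
a≤∣x∣⇒a*a≤x*x {a} {x} 0≤a a≤∣x∣ = begin
  a * a          ≤⟨ *-monoˡ-≤-nonNeg a {{nonNegative 0≤a}} a≤∣x∣ ⟩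
  a * ∣ x ∣      ≤⟨ *-monoʳ-≤-nonNeg ∣ x ∣ {{nonNegative (0≤∣p∣ x)}} a≤∣x∣ ⟩
  ∣ x ∣ * ∣ x ∣  ≡⟨ ∣p*q∣≡∣p∣*∣q∣ x x ⟨
  ∣ x * x ∣      ≡⟨ 0≤p⇒∣p∣≡p (0≤p*p x) ⟩
  x * x          ∎
  where open ≤-Reasoning

/1-homo-+ : ∀ m k → + (m ℕ.+ k) / 1 ≡ + m / 1 + + k / 1
/1-homo-+ m k = toℚᵘ-injective $ begin
  toℚᵘ (+ (m ℕ.+ k) / 1)              ≈⟨ toℚᵘ-fromℚᵘ (mkℚᵘ (+ (m ℕ.+ k)) 0) ⟩
  mkℚᵘ (+ m ℤ.+ + k) 0                ≈⟨ *≡* (ℤ-sum (+ m) (+ k)) ⟩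
  mkℚᵘ (+ m) 0 ℚᵘ.+ mkℚᵘ (+ k) 0      ≈⟨ ℚᵘ.+-cong (toℚᵘ-fromℚᵘ (mkℚᵘ (+ m) 0)) (toℚᵘ-fromℚᵘ (mkℚᵘ (+ k) 0)) ⟨
  toℚᵘ (+ m / 1) ℚᵘ.+ toℚᵘ (+ k / 1)  ≈⟨ toℚᵘ-homo-+ (+ m / 1) (+ k / 1) ⟨
  toℚᵘ (+ m / 1 + + k / 1)            ∎
  where
  open ℚᵘ.≃-Reasoning
  ℤ-sum : ∀ i j → (i ℤ.+ j) ℤ.* + 1 ≡ (i ℤ.* + 1 ℤ.+ j ℤ.* + 1) ℤ.* + 1
  ℤ-sum = ℤ-Solver.solve-∀

archimedean : ∀ y → 0ℚ < y → ∃[ M ] (1ℚ < + M / 1 * y)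
archimedean y 0<y = go y (positive 0<y)
  where
  -- For y = (k+1)/(d+1), the witness M = 2(d+1) gives M·y = 2(k+1).
  go : ∀ y → Positive y → ∃[ M ] (1ℚ < + M / 1 * y)
  go y@(mkℚ (+ suc k) d _) _ = M , toℚᵘ-cancel-< (ℚᵘ.<-respʳ-≃ (ℚᵘ.≃-sym My≃) (*<* (+<+ 1<M*y)))
    where
    M = 2 ℕ.* suc d
    My≃ : toℚᵘ (+ M / 1 * y) ℚᵘ.≃ mkℚᵘ (+ M) 0 ℚᵘ.* toℚᵘ y
    My≃ = ℚᵘ.≃-trans (toℚᵘ-homo-* (+ M / 1) y) (ℚᵘ.*-congʳ (toℚᵘ-fromℚᵘ (mkℚᵘ (+ M) 0)))
    1<M*y : 1 ℕ.* (1 ℕ.* suc d) ℕ.< M ℕ.* suc k ℕ.* 1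
    1<M*y = subst₂ ℕ._<_ (sym (trans (ℕ.*-identityˡ _) (ℕ.*-identityˡ _))) (sym (ℕ.*-identityʳ _))
      (ℕ.<-≤-trans (ℕ.m<m+n (suc d) ℕ.z<s) (ℕ.m≤m*n (suc d ℕ.+ (suc d ℕ.+ 0)) (suc k)))

Σ[Ω]≡sum : ∀ {n} (g : Fin n → ℚ) → Σ[Ω] n g ≡ sum g
Σ[Ω]≡sum {zero}  g = refl
Σ[Ω]≡sum {suc n} g = cong (_+_ (g 0F)) (Σ[Ω]≡sum (g ∘ Fin.suc))

Σ[Ω]-cong : ∀ {n} {g h : Fin n → ℚ} → (∀ i → g i ≡ h i) → Σ[Ω] n g ≡ Σ[Ω] n h
Σ[Ω]-cong {g = g} {h} g≗h = trans (Σ[Ω]≡sum g) (trans (sum-cong-≗ g≗h) (sym (Σ[Ω]≡sum h)))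

Σ[Ω]-distrib-+ : ∀ {n} (g h : Fin n → ℚ) → Σ[Ω] n (λ i → g i + h i) ≡ Σ[Ω] n g + Σ[Ω] n h
Σ[Ω]-distrib-+ g h =
  trans (Σ[Ω]≡sum (λ i → g i + h i)) (trans (∑-distrib-+ g h) (sym (cong₂ _+_ (Σ[Ω]≡sum g) (Σ[Ω]≡sum h))))

*-distribˡ-Σ[Ω] : ∀ {n} c (g : Fin n → ℚ) → c * Σ[Ω] n g ≡ Σ[Ω] n (λ i → c * g i)
*-distribˡ-Σ[Ω] c g =
  trans (cong (c *_) (Σ[Ω]≡sum g)) (trans (*-distribˡ-sum c g) (sym (Σ[Ω]≡sum (λ i → c * g i))))

Σ[Ω]-comm : ∀ {n} (g : Fin n → Fin n → ℚ) →
            Σ[Ω] n (λ i → Σ[Ω] n (g i)) ≡ Σ[Ω] n (λ j → Σ[Ω] n (λ i → g i j))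
Σ[Ω]-comm {n} g = begin
  Σ[Ω] n (λ i → Σ[Ω] n (g i))            ≡⟨ Σ[Ω]-cong (λ i → Σ[Ω]≡sum (g i)) ⟩
  Σ[Ω] n (λ i → sum (g i))               ≡⟨ Σ[Ω]≡sum (λ i → sum (g i)) ⟩
  sum (λ i → sum (g i))                  ≡⟨ ∑-comm g ⟩
  sum (λ j → sum (λ i → g i j))          ≡⟨ Σ[Ω]≡sum (λ j → sum (λ i → g i j)) ⟨
  Σ[Ω] n (λ j → sum (λ i → g i j))       ≡⟨ Σ[Ω]-cong (λ j → Σ[Ω]≡sum (λ i → g i j)) ⟨
  Σ[Ω] n (λ j → Σ[Ω] n (λ i → g i j))    ∎
  where open ≡-Reasoning

Σ[Ω]-mono-≤ : ∀ {n} {g h : Fin n → ℚ} → (∀ i → g i ≤ h i) → Σ[Ω] n g ≤ Σ[Ω] n h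
Σ[Ω]-mono-≤ {zero}  g≤h = ≤-refl
Σ[Ω]-mono-≤ {suc n} g≤h = +-mono-≤ (g≤h 0F) (Σ[Ω]-mono-≤ (g≤h ∘ Fin.suc))

Σ[Ω]-nonNeg : ∀ {n} {g : Fin n → ℚ} → (∀ i → 0ℚ ≤ g i) → 0ℚ ≤ Σ[Ω] n g
Σ[Ω]-nonNeg {zero}  0≤g = ≤-refl
Σ[Ω]-nonNeg {suc n} 0≤g = +-mono-≤ (0≤g 0F) (Σ[Ω]-nonNeg (0≤g ∘ Fin.suc))

Σ[Ω]-pos : ∀ {n} {g : Fin n → ℚ} → (∀ i → 0ℚ ≤ g i) → ∀ i → 0ℚ < g i → 0ℚ < Σ[Ω] n g
Σ[Ω]-pos 0≤g 0F          0<gi = +-mono-<-≤ 0<gi (Σ[Ω]-nonNeg (0≤g ∘ Fin.suc))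
Σ[Ω]-pos 0≤g (Fin.suc i) 0<gi = +-mono-≤-< (0≤g 0F) (Σ[Ω]-pos (0≤g ∘ Fin.suc) i 0<gi)

1/-cong : ∀ {p q} .{{_ : NonZero p}} .{{_ : NonZero q}} → p ≡ q → 1/ p ≡ 1/ q
1/-cong refl = refl

T-from-≡ : ∀ {b} → b ≡ true → T b
T-from-≡ = Equivalence.from T-≡

if-T : ∀ {b} {A : Set} {x y : A} → T b → (if b then x else y) ≡ x
if-T {true} _ = refl

if-nonNeg : ∀ b {x} → 0ℚ ≤ x → 0ℚ ≤ (if b then x else 0ℚ)
if-nonNeg true  0≤x = 0≤x
if-nonNeg false _   = ≤-refl

𝟙 : Bool → ℚ
𝟙 true  = 1ℚ
𝟙 false = 0ℚ

0≤1 : 0ℚ ≤ 1ℚ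
0≤1 = nonNegative⁻¹ 1ℚ

𝟙-does-≤ : ∀ {P : Set} (P? : Dec P) {c x} → 0ℚ ≤ x → (P → c ≤ x) → c * 𝟙 (does P?) ≤ x
𝟙-does-≤ (yes p) {c} _   c≤x = subst (_≤ _) (sym (*-identityʳ c)) (c≤x p)
𝟙-does-≤ (no _)  {c} 0≤x _   = subst (_≤ _) (sym (*-zeroʳ c)) 0≤x

𝟙≤1 : ∀ b → 𝟙 b ≤ 1ℚ
𝟙≤1 true  = ≤-refl
𝟙≤1 false = 0≤1

0≤p⇒0≤1/p : ∀ p .{{_ : NonZero p}} → 0ℚ ≤ p → 0ℚ ≤ 1/ p
0≤p⇒0≤1/p p 0≤p = <⇒≤ (positive⁻¹ _ {{1/pos⇒pos p {{nonNeg∧nonZero⇒pos p {{nonNegative 0≤p}}}}}})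

does-true : ∀ {P : Set} (P? : Dec P) → does P? ≡ true → P
does-true (yes p) _ = p

does-false : ∀ {P : Set} (P? : Dec P) → does P? ≡ false → ¬ P
does-false (no ¬p) _ = ¬p

record IsPartition {n} (R : Fin n → Event n) : Set where
  field
    own-block  : ∀ ω → T (R ω ω)
    same-block : ∀ {ω ω'} → T (R ω ω') → ∀ z → R ω' z ≡ R ω z

  block-sym : ∀ {ω ω'} → T (R ω ω') → T (R ω' ω)
  block-sym {ω} ω∼ω' = subst T (sym (same-block ω∼ω' ω)) (own-block ω)

Refines : ∀ {n} → (Fin n → Event n) → (Fin n → Event n) → Set
Refines Q R = ∀ {ω ω'} → T (Q ω ω') → T (R ω ω')

Measurable : ∀ {n} {A : Set} → (Fin n → Event n) → (Fin n → A) → Set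
Measurable R g = ∀ {ω ω'} → T (R ω ω') → g ω' ≡ g ω

Measurable-refines : ∀ {n} {A : Set} {Q R : Fin n → Event n} {g : Fin n → A} →
                     Refines Q R → Measurable R g → Measurable Q g
Measurable-refines Q⊆R g-meas = g-meas ∘ Q⊆R

block-isPartition : ∀ {n} (p : Partition n) → IsPartition (block p)
block-isPartition p = record
  { own-block  = λ ω → ℕ.≡⇒≡ᵇ (p ω) (p ω) refl
  ; same-block = λ {ω} {ω'} ω∼ω' z → cong (p z ℕ.≡ᵇ_) (ℕ.≡ᵇ⇒≡ (p ω') (p ω) ω∼ω')
  }

IsPartition-resp : ∀ {n} {R R' : Fin n → Event n} → (∀ ω → R ω ≡ R' ω) → IsPartition R → IsPartition R'
IsPartition-resp {R = R} {R'} R≡R' R-part = record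
  { own-block  = λ ω → subst (λ S → T (S ω)) (R≡R' ω) (own-block ω)
  ; same-block = λ {ω} {ω'} ω∼ω' z → begin
      R' ω' z  ≡⟨ cong-app (R≡R' ω') z ⟨
      R ω' z   ≡⟨ same-block (subst (λ S → T (S ω')) (sym (R≡R' ω)) ω∼ω') z ⟩
      R ω z    ≡⟨ cong-app (R≡R' ω) z ⟩
      R' ω z   ∎
  }
  where
  open IsPartition R-part
  open ≡-Reasoning

Refines-resp : ∀ {n} {Q Q' R R' : Fin n → Event n} → (∀ ω → Q ω ≡ Q' ω) → (∀ ω → R ω ≡ R' ω) →
               Refines Q R → Refines Q' R'
Refines-resp Q≡Q' R≡R' Q⊆R {ω} {ω'} =
  subst (λ S → T (S ω')) (R≡R' ω) ∘ Q⊆R ∘ subst (λ S → T (S ω')) (sym (Q≡Q' ω))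

module Expectation {n : ℕ} (D : Fin n → ℚ) where

  E[_∣_] : (Fin n → ℚ) → Event n → ℚ
  E[ h ∣ S ] = condExp n D h S

  𝔼 : (Fin n → ℚ) → ℚ
  𝔼 g = Σ[Ω] n (λ ω → D ω * g ω)

  𝔼-cong : ∀ {g h} → (∀ ω → g ω ≡ h ω) → 𝔼 g ≡ 𝔼 h
  𝔼-cong g≗h = Σ[Ω]-cong (λ ω → cong (D ω *_) (g≗h ω))

  𝔼-+ : ∀ g h → 𝔼 (λ ω → g ω + h ω) ≡ 𝔼 g + 𝔼 h
  𝔼-+ g h = trans (Σ[Ω]-cong (λ ω → *-distribˡ-+ (D ω) (g ω) (h ω)))
                  (Σ[Ω]-distrib-+ (λ ω → D ω * g ω) (λ ω → D ω * h ω))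

  𝔼-* : ∀ c g → 𝔼 (λ ω → c * g ω) ≡ c * 𝔼 g
  𝔼-* c g = trans (Σ[Ω]-cong (λ ω → D*c*g≡c*D*g (D ω) c (g ω))) (sym (*-distribˡ-Σ[Ω] c (λ ω → D ω * g ω)))
    where
    D*c*g≡c*D*g : ∀ d c g → d * (c * g) ≡ c * (d * g)
    D*c*g≡c*D*g = solve 3 (λ d c g → d :* (c :* g) := c :* (d :* g)) refl

  𝔼-sub : ∀ g h → 𝔼 (λ ω → g ω - h ω) ≡ 𝔼 g - 𝔼 h
  𝔼-sub g h = begin
    𝔼 (λ ω → g ω - h ω)               ≡⟨ 𝔼-cong (λ ω → sub≡add-neg (g ω) (h ω)) ⟩
    𝔼 (λ ω → g ω + - 1ℚ * h ω)        ≡⟨ 𝔼-+ g (λ ω → - 1ℚ * h ω) ⟩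
    𝔼 g + 𝔼 (λ ω → - 1ℚ * h ω)        ≡⟨ cong (_+_ (𝔼 g)) (𝔼-* (- 1ℚ) h) ⟩
    𝔼 g + - 1ℚ * 𝔼 h                  ≡⟨ sub≡add-neg (𝔼 g) (𝔼 h) ⟨
    𝔼 g - 𝔼 h                         ∎
    where
    open ≡-Reasoning
    sub≡add-neg : ∀ x y → x - y ≡ x + - 1ℚ * y
    sub≡add-neg = solve 2 (λ x y → x :- y := x :+ con (- 1ℚ) :* y) refl

  𝔼-zero : 𝔼 (λ _ → 0ℚ) ≡ 0ℚ
  𝔼-zero = trans (𝔼-* 0ℚ (λ _ → 0ℚ)) (*-zeroˡ (𝔼 (λ _ → 0ℚ)))

  Pr-cong : ∀ {S S'} → (∀ z → S z ≡ S' z) → Pr n D S ≡ Pr n D S'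
  Pr-cong S≗S' = Σ[Ω]-cong (λ z → cong (λ b → if b then D z else 0ℚ) (S≗S' z))

  Pr≡𝔼𝟙 : ∀ S → Pr n D S ≡ 𝔼 (𝟙 ∘ S)
  Pr≡𝔼𝟙 S = Σ[Ω]-cong (λ ω → masked≡D*𝟙 (S ω) ω)
    where
    masked≡D*𝟙 : ∀ b ω → (if b then D ω else 0ℚ) ≡ D ω * 𝟙 b
    masked≡D*𝟙 true  ω = sym (*-identityʳ (D ω))
    masked≡D*𝟙 false ω = sym (*-zeroʳ (D ω))

  condExp-cong : ∀ h {S S'} → (∀ z → S z ≡ S' z) → E[ h ∣ S ] ≡ E[ h ∣ S' ]
  condExp-cong h {S} {S'} S≗S' with Pr n D S ≟ 0ℚ | Pr n D S' ≟ 0ℚ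
  ... | yes _   | yes _    = refl
  ... | no P≢0  | no P'≢0 = cong₂ _*_ (Σ[Ω]-cong (λ z → cong (λ b → if b then D z * h z else 0ℚ) (S≗S' z)))
                                       (1/-cong {{≢-nonZero P≢0}} {{≢-nonZero P'≢0}} (Pr-cong S≗S'))
  ... | yes P≡0 | no P'≢0  = contradiction (trans (sym (Pr-cong S≗S')) P≡0) P'≢0
  ... | no P≢0  | yes P'≡0 = contradiction (trans (Pr-cong S≗S') P'≡0) P≢0

  condExp-measurable : ∀ h {R} → IsPartition R → Measurable R (λ ω → E[ h ∣ R ω ])
  condExp-measurable h R-part ω∼ω' = condExp-cong h (IsPartition.same-block R-part ω∼ω')

  condExp-unfold : ∀ h S (P≢0 : Pr n D S ≢ 0ℚ) →
    E[ h ∣ S ] ≡ Σ[Ω] n (λ z → if S z then D z * h z else 0ℚ) * (1/ Pr n D S) {{≢-nonZero P≢0}}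
  condExp-unfold h S P≢0 with Pr n D S ≟ 0ℚ
  ... | yes P≡0 = contradiction P≡0 P≢0
  ... | no _    = refl

  module FullSupport (D>0 : ∀ ω → 0ℚ < D ω) where

    𝔼-mono-≤ : ∀ {g h} → (∀ ω → g ω ≤ h ω) → 𝔼 g ≤ 𝔼 h
    𝔼-mono-≤ g≤h = Σ[Ω]-mono-≤ (λ ω → *-monoˡ-≤-nonNeg (D ω) {{nonNegative (<⇒≤ (D>0 ω))}} (g≤h ω))

    𝔼-nonNeg : ∀ {g} → (∀ ω → 0ℚ ≤ g ω) → 0ℚ ≤ 𝔼 g
    𝔼-nonNeg 0≤g = Σ[Ω]-nonNeg (λ ω → 0≤p*q (<⇒≤ (D>0 ω)) (0≤g ω))

    𝔼≤Σ[Ω]D : ∀ {g} → (∀ ω → g ω ≤ 1ℚ) → 𝔼 g ≤ Σ[Ω] n D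
    𝔼≤Σ[Ω]D {g} g≤1 = subst (𝔼 g ≤_) (Σ[Ω]-cong (λ ω → *-identityʳ (D ω))) (𝔼-mono-≤ g≤1)

    Pr-pos : ∀ {S ω} → T (S ω) → 0ℚ < Pr n D S
    Pr-pos {S} {ω} ω∈S =
      Σ[Ω]-pos (λ z → if-nonNeg (S z) (<⇒≤ (D>0 z))) ω (subst (0ℚ <_) (sym (if-T ω∈S)) (D>0 ω))

    condExp-bounds : ∀ {h} → (∀ ω → 0ℚ ≤ h ω) → (∀ ω → h ω ≤ 1ℚ) →
                     ∀ S → 0ℚ ≤ E[ h ∣ S ] × E[ h ∣ S ] ≤ 1ℚ
    condExp-bounds {h} 0≤h h≤1 S with Pr n D S ≟ 0ℚ
    ... | yes _   = ≤-refl , 0≤1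
    ... | no P≢0  = 0≤p*q 0≤N (0≤p⇒0≤1/p P 0≤P) , (begin
        N * 1/ P  ≤⟨ *-monoʳ-≤-nonNeg (1/ P) {{nonNegative (0≤p⇒0≤1/p P 0≤P)}} N≤P ⟩
        P * 1/ P  ≡⟨ *-inverseʳ P ⟩
        1ℚ        ∎)
      where
      open ≤-Reasoning
      P = Pr n D S
      N = Σ[Ω] n (λ z → if S z then D z * h z else 0ℚ)
      instance _ = ≢-nonZero P≢0
      0≤D : ∀ z → 0ℚ ≤ D z
      0≤D z = <⇒≤ (D>0 z)
      0≤P : 0ℚ ≤ P
      0≤P = Σ[Ω]-nonNeg (λ z → if-nonNeg (S z) (0≤D z))
      0≤N : 0ℚ ≤ N
      0≤N = Σ[Ω]-nonNeg (λ z → if-nonNeg (S z) (0≤p*q (0≤D z) (0≤h z)))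
      N≤P : N ≤ P
      N≤P = Σ[Ω]-mono-≤ (λ z → masked≤ (S z) z)
        where
        masked≤ : ∀ b z → (if b then D z * h z else 0ℚ) ≤ (if b then D z else 0ℚ)
        masked≤ true  z = subst (D z * h z ≤_) (*-identityʳ (D z))
                                (*-monoˡ-≤-nonNeg (D z) {{nonNegative (0≤D z)}} (h≤1 z))
        masked≤ false z = ≤-refl

    tower : ∀ h {R} {g : Fin n → ℚ} → IsPartition R → Measurable R g →
            𝔼 (λ ω → E[ h ∣ R ω ] * g ω) ≡ 𝔼 (λ ω → h ω * g ω)
    -- Expanding E[ h ∣ R ω ] as a ratio gives a double sum over pairs in the same block, which is
    -- symmetric because g and Pr (R ·) are constant on blocks.
    tower h {R} {g} R-part g-meas = begin
      𝔼 (λ ω → E[ h ∣ R ω ] * g ω)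
        ≡⟨ 𝔼-cong (λ ω → cong (_* g ω) (condExp-unfold h (R ω) (P≢0 ω))) ⟩
      Σ[Ω] n (λ ω → D ω * (N ω * Ī ω * g ω))
        ≡⟨ Σ[Ω]-cong (λ ω → trans (regroup (D ω) (N ω) (Ī ω) (g ω)) (*-distribˡ-Σ[Ω] (c ω) (masked-h ω))) ⟩
      Σ[Ω] n (λ ω → Σ[Ω] n (λ ω' → c ω * masked-h ω ω'))
        ≡⟨ Σ[Ω]-cong (λ ω → Σ[Ω]-cong (swap-block ω)) ⟩
      Σ[Ω] n (λ ω → Σ[Ω] n (λ ω' → c' ω' * masked-D ω' ω))
        ≡⟨ Σ[Ω]-comm (λ ω ω' → c' ω' * masked-D ω' ω) ⟩
      Σ[Ω] n (λ ω' → Σ[Ω] n (λ ω → c' ω' * masked-D ω' ω))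
        ≡⟨ Σ[Ω]-cong (λ ω' → sym (*-distribˡ-Σ[Ω] (c' ω') (masked-D ω'))) ⟩
      Σ[Ω] n (λ ω' → c' ω' * P ω')
        ≡⟨ Σ[Ω]-cong cancel ⟩
      𝔼 (λ ω → h ω * g ω) ∎
      where
      open ≡-Reasoning
      open IsPartition R-part
      masked-h masked-D : Fin n → Fin n → ℚ
      masked-h ω z = if R ω z then D z * h z else 0ℚ
      masked-D ω z = if R ω z then D z else 0ℚ
      P N : Fin n → ℚ
      P ω = Pr n D (R ω)
      N ω = Σ[Ω] n (masked-h ω)
      P≢0 : ∀ ω → P ω ≢ 0ℚ
      P≢0 ω P≡0 = <-irrefl (sym P≡0) (Pr-pos (own-block ω))
      instance
        P-nonZero : ∀ {ω} → NonZero (P ω)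
        P-nonZero {ω} = ≢-nonZero (P≢0 ω)
      Ī c c' : Fin n → ℚ
      Ī ω = 1/ P ω
      c ω = D ω * g ω * Ī ω
      c' ω = D ω * h ω * g ω * Ī ω

      regroup : ∀ d m i x → d * (m * i * x) ≡ d * x * i * m
      regroup = solve 4 (λ d m i x → d :* (m :* i :* x) := d :* x :* i :* m) refl

      swap-block : ∀ ω ω' → c ω * masked-h ω ω' ≡ c' ω' * masked-D ω' ω
      swap-block ω ω' with R ω ω' in ω∼ω' | R ω' ω in ω'∼ω
      ... | false | false = trans (*-zeroʳ (c ω)) (sym (*-zeroʳ (c' ω')))
      ... | true  | false = contradiction (subst T ω'∼ω (block-sym (T-from-≡ ω∼ω'))) λ ()
      ... | false | true  = contradiction (subst T ω∼ω' (block-sym (T-from-≡ ω'∼ω))) λ ()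
      ... | true  | true  = begin
        D ω * g ω * Ī ω * (D ω' * h ω')   ≡⟨ rearrange (D ω) (g ω) (Ī ω) (D ω') (h ω') ⟩
        D ω' * h ω' * g ω * Ī ω * D ω     ≡⟨ cong₂ (λ x i → D ω' * h ω' * x * i * D ω) g≡ Ī≡ ⟩
        D ω' * h ω' * g ω' * Ī ω' * D ω   ∎
        where
        rearrange : ∀ d x i d' y → d * x * i * (d' * y) ≡ d' * y * x * i * d
        rearrange = solve 5 (λ d x i d' y → d :* x :* i :* (d' :* y) := d' :* y :* x :* i :* d) refl
        g≡ : g ω ≡ g ω'
        g≡ = sym (g-meas (T-from-≡ ω∼ω'))
        Ī≡ : Ī ω ≡ Ī ω'
        Ī≡ = 1/-cong (sym (Pr-cong (same-block (T-from-≡ ω∼ω'))))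

      cancel : ∀ ω → c' ω * P ω ≡ D ω * (h ω * g ω)
      cancel ω = begin
        D ω * h ω * g ω * Ī ω * P ω      ≡⟨ regroup′ (D ω) (h ω) (g ω) (Ī ω) (P ω) ⟩
        D ω * (h ω * g ω) * (Ī ω * P ω)  ≡⟨ cong (D ω * (h ω * g ω) *_) (*-inverseˡ (P ω)) ⟩
        D ω * (h ω * g ω) * 1ℚ           ≡⟨ *-identityʳ _ ⟩
        D ω * (h ω * g ω)                ∎
        where
        regroup′ : ∀ d x y i p → d * x * y * i * p ≡ d * (x * y) * (i * p)
        regroup′ = solve 5 (λ d x y i p → d :* x :* y :* i :* p := d :* (x :* y) :* (i :* p)) refl

    pythagoras : ∀ h {Q R} → IsPartition Q → IsPartition R → Refines Q R →
      𝔼 (λ ω → (E[ h ∣ Q ω ] - E[ h ∣ R ω ]) * (E[ h ∣ Q ω ] - E[ h ∣ R ω ]))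
        ≡ 𝔼 (λ ω → E[ h ∣ Q ω ] * E[ h ∣ Q ω ]) - 𝔼 (λ ω → E[ h ∣ R ω ] * E[ h ∣ R ω ])
    pythagoras h {Q} {R} Q-part R-part Q⊆R = begin
      𝔼 (λ ω → (x ω - y ω) * (x ω - y ω))
        ≡⟨ 𝔼-cong (λ ω → expand (x ω) (y ω)) ⟩
      𝔼 (λ ω → (x ω * x ω - y ω * y ω) - 2ℚ * (x ω * y ω - y ω * y ω))
        ≡⟨ 𝔼-sub _ _ ⟩
      𝔼 (λ ω → x ω * x ω - y ω * y ω) - 𝔼 (λ ω → 2ℚ * (x ω * y ω - y ω * y ω))
        ≡⟨ cong₂ _-_ (𝔼-sub _ _) (trans (𝔼-* 2ℚ _) (cong (2ℚ *_) (𝔼-sub _ _))) ⟩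
      (𝔼 xx - 𝔼 yy) - 2ℚ * (𝔼 xy - 𝔼 yy)
        ≡⟨ cong (λ z → (𝔼 xx - 𝔼 yy) - 2ℚ * (z - 𝔼 yy)) cross ⟩
      (𝔼 xx - 𝔼 yy) - 2ℚ * (𝔼 yy - 𝔼 yy)
        ≡⟨ cancel (𝔼 xx) (𝔼 yy) ⟩
      𝔼 xx - 𝔼 yy ∎
      where
      open ≡-Reasoning
      2ℚ = 1ℚ + 1ℚ
      x y xx xy yy : Fin n → ℚ
      x ω = E[ h ∣ Q ω ]
      y ω = E[ h ∣ R ω ]
      xx ω = x ω * x ω
      xy ω = x ω * y ω
      yy ω = y ω * y ω
      expand : ∀ u v → (u - v) * (u - v) ≡ (u * u - v * v) - 2ℚ * (u * v - v * v)
      expand = solve 2 (λ u v → (u :- v) :* (u :- v) := (u :* u :- v :* v) :- con 2ℚ :* (u :* v :- v :* v))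
                       refl
      cancel : ∀ u v → (u - v) - 2ℚ * (v - v) ≡ u - v
      cancel = solve 2 (λ u v → (u :- v) :- con 2ℚ :* (v :- v) := u :- v) refl
      y-meas : Measurable R y
      y-meas = condExp-measurable h R-part
      cross : 𝔼 xy ≡ 𝔼 yy
      cross = trans (tower h Q-part (Measurable-refines {Q = Q} {R} {y} Q⊆R y-meas))
                    (sym (tower h R-part y-meas))

    information-gain : ∀ h {S C C'} {s : Fin n → ℚ} {a} →
      IsPartition S → IsPartition C → IsPartition C' → Measurable S s → Measurable C' s → 0ℚ ≤ a →
      (∀ ω → a * (s ω * s ω) ≤ (E[ h ∣ S ω ] - E[ h ∣ C ω ]) * s ω) →
      a * a * 𝔼 (λ ω → s ω * s ω)
        ≤ 𝔼 (λ ω → (E[ h ∣ C' ω ] - E[ h ∣ C ω ]) * (E[ h ∣ C' ω ] - E[ h ∣ C ω ]))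
    -- By the tower property s is as correlated with E[ h ∣ C' ] as with E[ h ∣ S ], so Charlie's
    -- jump X has 𝔼[X s] ≥ a 𝔼[s²]; completing the square, 𝔼[X²] ≥ 2a 𝔼[X s] - a² 𝔼[s²].
    information-gain h {S} {C} {C'} {s} {a} S-part C-part C'-part s-S s-C' 0≤a margin =
      ≤-by-diff decomposition
        (+-mono-≤ (𝔼-nonNeg (λ ω → 0≤p*p (X ω - a * s ω)))
                  (0≤p*q (+-mono-≤ 0≤a 0≤a) (p≤q⇒0≤q-p a𝔼s²≤𝔼Xs)))
      where
      open ≡-Reasoning
      distrib : ∀ u v s → (u - v) * s ≡ u * s - v * s
      distrib = solve 3 (λ u v s → (u :- v) :* s := u :* s :- v :* s) refl
      X ss Xs : Fin n → ℚ
      X ω = E[ h ∣ C' ω ] - E[ h ∣ C ω ]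
      ss ω = s ω * s ω
      Xs ω = X ω * s ω

      cross : 𝔼 Xs ≡ 𝔼 (λ ω → (E[ h ∣ S ω ] - E[ h ∣ C ω ]) * s ω)
      cross = begin
        𝔼 Xs
          ≡⟨ 𝔼-cong (λ ω → distrib E[ h ∣ C' ω ] E[ h ∣ C ω ] (s ω)) ⟩
        𝔼 (λ ω → E[ h ∣ C' ω ] * s ω - E[ h ∣ C ω ] * s ω)
          ≡⟨ 𝔼-sub _ _ ⟩
        𝔼 (λ ω → E[ h ∣ C' ω ] * s ω) - 𝔼 (λ ω → E[ h ∣ C ω ] * s ω)
          ≡⟨ cong (_- 𝔼 (λ ω → E[ h ∣ C ω ] * s ω)) (trans (tower h C'-part s-C') (sym (tower h S-part s-S))) ⟩
        𝔼 (λ ω → E[ h ∣ S ω ] * s ω) - 𝔼 (λ ω → E[ h ∣ C ω ] * s ω)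
          ≡⟨ 𝔼-sub _ _ ⟨
        𝔼 (λ ω → E[ h ∣ S ω ] * s ω - E[ h ∣ C ω ] * s ω)
          ≡⟨ 𝔼-cong (λ ω → distrib E[ h ∣ S ω ] E[ h ∣ C ω ] (s ω)) ⟨
        𝔼 (λ ω → (E[ h ∣ S ω ] - E[ h ∣ C ω ]) * s ω) ∎

      a𝔼s²≤𝔼Xs : a * 𝔼 ss ≤ 𝔼 Xs
      a𝔼s²≤𝔼Xs = subst₂ _≤_ (𝔼-* a ss) (sym cross) (𝔼-mono-≤ margin)

      decomposition : 𝔼 (λ ω → X ω * X ω) - a * a * 𝔼 ss
                    ≡ 𝔼 (λ ω → (X ω - a * s ω) * (X ω - a * s ω)) + (a + a) * (𝔼 Xs - a * 𝔼 ss)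
      decomposition = begin
        𝔼 (λ ω → X ω * X ω) - a * a * 𝔼 ss
          ≡⟨ cong (_-_ (𝔼 (λ ω → X ω * X ω))) (𝔼-* (a * a) ss) ⟨
        𝔼 (λ ω → X ω * X ω) - 𝔼 (λ ω → a * a * ss ω)
          ≡⟨ 𝔼-sub _ _ ⟨
        𝔼 (λ ω → X ω * X ω - a * a * ss ω)
          ≡⟨ 𝔼-cong (λ ω → complete-square (X ω) (s ω) a) ⟩
        𝔼 (λ ω → (X ω - a * s ω) * (X ω - a * s ω) + (a + a) * (Xs ω - a * ss ω))
          ≡⟨ 𝔼-+ _ _ ⟩
        𝔼 (λ ω → (X ω - a * s ω) * (X ω - a * s ω)) + 𝔼 (λ ω → (a + a) * (Xs ω - a * ss ω))
          ≡⟨ cong (_+_ (𝔼 (λ ω → (X ω - a * s ω) * (X ω - a * s ω))))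
                  (trans (𝔼-* (a + a) _)
                         (cong ((a + a) *_) (trans (𝔼-sub Xs _) (cong (_-_ (𝔼 Xs)) (𝔼-* a ss))))) ⟩
        𝔼 (λ ω → (X ω - a * s ω) * (X ω - a * s ω)) + (a + a) * (𝔼 Xs - a * 𝔼 ss) ∎
        where
        complete-square : ∀ x s a → x * x - a * a * (s * s)
                                  ≡ (x - a * s) * (x - a * s) + (a + a) * (x * s - a * (s * s))
        complete-square = solve 3 (λ x s a → x :* x :- a :* a :* (s :* s)
                                    := (x :- a :* s) :* (x :- a :* s) :+ (a :+ a) :* (x :* s :- a :* (s :* s)))
                                  refl

sgn : Msg → ℚ
sgn high   = 1ℚ
sgn low    = - 1ℚ
sgn medium = 0ℚ

sgn²-cases : ∀ m → m ≡ medium ⊎ sgn m * sgn m ≡ 1ℚ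
sgn²-cases high   = inj₂ refl
sgn²-cases low    = inj₂ refl
sgn²-cases medium = inj₁ refl

data DiscMsgSpec (ε e eC : ℚ) : Msg → Set where
  high   : eC + ε * quarter < e → DiscMsgSpec ε e eC high
  low    : e < eC - ε * quarter → DiscMsgSpec ε e eC low
  medium : e ≤ eC + ε * quarter → eC - ε * quarter ≤ e → DiscMsgSpec ε e eC medium

discMsg-spec : ∀ ε e eC → DiscMsgSpec ε e eC (discMsg ε e eC)
discMsg-spec ε e eC with does (eC + ε * quarter <? e) in above | does (e <? eC - ε * quarter) in below
... | true  | _     = high (does-true (eC + ε * quarter <? e) above)
... | false | true  = low (does-true (e <? eC - ε * quarter) below)
... | false | false = medium (≮⇒≥ (does-false (eC + ε * quarter <? e) above))
                             (≮⇒≥ (does-false (e <? eC - ε * quarter) below))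

discMsg-sgn : ∀ ε e eC → let m = discMsg ε e eC in ε * quarter * (sgn m * sgn m) ≤ (e - eC) * sgn m
discMsg-sgn ε e eC with discMsg ε e eC | discMsg-spec ε e eC
... | high   | high above = ≤-by-diff (high-margin e eC (ε * quarter)) (p≤q⇒0≤q-p (<⇒≤ above))
  where
  high-margin : ∀ e c a → (e - c) * 1ℚ - a * (1ℚ * 1ℚ) ≡ e - (c + a)
  high-margin = solve 3 (λ e c a → (e :- c) :* con 1ℚ :- a :* (con 1ℚ :* con 1ℚ) := e :- (c :+ a)) refl
... | low    | low below  = ≤-by-diff (low-margin e eC (ε * quarter)) (p≤q⇒0≤q-p (<⇒≤ below))
  where
  low-margin : ∀ e c a → (e - c) * - 1ℚ - a * (- 1ℚ * - 1ℚ) ≡ (c - a) - e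
  low-margin = solve 3 (λ e c a → (e :- c) :* con (- 1ℚ) :- a :* (con (- 1ℚ) :* con (- 1ℚ)) := (c :- a) :- e)
                       refl
... | medium | medium _ _  = ≤-reflexive (trans (*-zeroʳ (ε * quarter)) (sym (*-zeroʳ (e - eC))))

discMsg-medium : ∀ ε e eC → discMsg ε e eC ≡ medium → ∣ e - eC ∣ ≤ ε * quarter
discMsg-medium ε e eC with discMsg ε e eC | discMsg-spec ε e eC
... | medium | medium e≤ ≤e = λ _ →
  ∣p∣≤q (≤-by-diff (lower e eC (ε * quarter)) (p≤q⇒0≤q-p ≤e))
        (≤-by-diff (upper e eC (ε * quarter)) (p≤q⇒0≤q-p e≤))
  where
  lower : ∀ e c a → (e - c) - (- a) ≡ e - (c - a)
  lower = solve 3 (λ e c a → (e :- c) :- (:- a) := e :- (c :- a)) refl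
  upper : ∀ e c a → a - (e - c) ≡ (c + a) - e
  upper = solve 3 (λ e c a → a :- (e :- c) := (c :+ a) :- e) refl
... | high   | high _  = λ ()
... | low    | low _   = λ ()

triangle-separation : ∀ {ε eA eB c c'} → ∣ eA - c ∣ ≤ ε * quarter → ∣ eB - c' ∣ ≤ ε * quarter →
                      ε < ∣ eA - eB ∣ → ε * quarter ≤ ∣ c' - c ∣
triangle-separation {ε} {eA} {eB} {c} {c'} eA≈c eB≈c' apart =
  ≤-by-diff (slack (∣ c' - c ∣) ε) (+-mono-≤ (p≤q⇒0≤q-p (<⇒≤ ε<2a+d)) 0≤a)
  where
  a = ε * quarter
  0≤a : 0ℚ ≤ a
  0≤a = ≤-trans (0≤∣p∣ (eA - c)) eA≈c
  split : ∀ eA eB c c' → eA - eB ≡ (eA - c) - (c' - c) - (eB - c')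
  split = solve 4 (λ eA eB c c' → eA :- eB := (eA :- c) :- (c' :- c) :- (eB :- c')) refl
  ε<2a+d : ε < a + ∣ c' - c ∣ + a
  ε<2a+d = begin-strict
    ε                                               <⟨ apart ⟩
    ∣ eA - eB ∣                                     ≡⟨ cong ∣_∣ (split eA eB c c') ⟩
    ∣ (eA - c) - (c' - c) - (eB - c') ∣             ≤⟨ ∣x-y-z∣≤∣x∣+∣y∣+∣z∣ (eA - c) (c' - c) (eB - c') ⟩
    ∣ eA - c ∣ + ∣ c' - c ∣ + ∣ eB - c' ∣           ≤⟨ +-mono-≤ (+-monoˡ-≤ ∣ c' - c ∣ eA≈c) eB≈c' ⟩
    a + ∣ c' - c ∣ + a                              ∎
    where open ≤-Reasoning
  slack : ∀ d ε → d - ε * quarter ≡ (ε * quarter + d + ε * quarter - ε) + ε * quarter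
  slack = solve 2 (λ d ε → d :- ε :* con quarter
                           := (ε :* con quarter :+ d :+ ε :* con quarter :- ε) :+ ε :* con quarter)
                  refl

==ᴹ-refl : ∀ m → T (m ==ᴹ m)
==ᴹ-refl high   = _
==ᴹ-refl low    = _
==ᴹ-refl medium = _

==ᴹ-sound : ∀ {m m'} → T (m ==ᴹ m') → m ≡ m'
==ᴹ-sound {high}   {high}   _ = refl
==ᴹ-sound {low}    {low}    _ = refl
==ᴹ-sound {medium} {medium} _ = refl
==ᴹ-sound {high}   {low}    ()
==ᴹ-sound {high}   {medium} ()
==ᴹ-sound {low}    {high}   ()
==ᴹ-sound {low}    {medium} ()
==ᴹ-sound {medium} {high}   ()
==ᴹ-sound {medium} {low}    ()

module _ {n : ℕ} where

  learn : (Fin n → Event n) → (Fin n → Msg) → Fin n → Event n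
  learn R m ω ω' = R ω ω' ∧ (m ω' ==ᴹ m ω)

  module _ {R : Fin n → Event n} (m : Fin n → Msg) where

    learn-isPartition : IsPartition R → IsPartition (learn R m)
    learn-isPartition R-part = record
      { own-block  = λ ω → Equivalence.from T-∧ (own-block ω , ==ᴹ-refl (m ω))
      ; same-block = λ ω∼ω' z → let ω∈R , m≡ = Equivalence.to T-∧ ω∼ω' in
          cong₂ _∧_ (same-block ω∈R z) (cong (m z ==ᴹ_) (==ᴹ-sound m≡))
      }
      where open IsPartition R-part

    learn-refines-self : Refines (learn R m) R
    learn-refines-self = proj₁ ∘ Equivalence.to T-∧

    learn-measurable : Measurable (learn R m) m
    learn-measurable = ==ᴹ-sound ∘ proj₂ ∘ Equivalence.to T-∧

    learn-mono : ∀ {Q} → Refines Q R → Refines (learn Q m) (learn R m)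
    learn-mono Q⊆R ω∼ω' = let ω∈Q , m≡ = Equivalence.to T-∧ ω∼ω' in Equivalence.from T-∧ (Q⊆R ω∈Q , m≡)

    refines-learn : ∀ {Q} → Refines Q R → Measurable Q m → Refines Q (learn R m)
    refines-learn Q⊆R m-meas {ω} ω∼ω' =
      Equivalence.from T-∧ (Q⊆R ω∼ω' , subst (λ x → T (x ==ᴹ m ω)) (sym (m-meas ω∼ω')) (==ᴹ-refl (m ω)))

  update : Bool → (Fin n → Msg) → Knowledge n → Knowledge n
  update true  m K ω = knowA K ω , learn (knowB K) m ω , learn (knowC K) m ω
  update false m K ω = learn (knowA K) m ω , knowB K ω , learn (knowC K) m ω

  speaker : Bool → Knowledge n → Fin n → Event n
  speaker b K ω = if b then knowA K ω else knowB K ω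

  record Consistent (K : Knowledge n) : Set where
    field
      A-part : IsPartition (knowA K)
      B-part : IsPartition (knowB K)
      C-part : IsPartition (knowC K)
      A⊆C    : Refines (knowA K) (knowC K)
      B⊆C    : Refines (knowB K) (knowC K)

    speaker-isPartition : ∀ b → IsPartition (speaker b K)
    speaker-isPartition true  = A-part
    speaker-isPartition false = B-part

    speaker⊆C : ∀ b → Refines (speaker b K) (knowC K)
    speaker⊆C true  = A⊆C
    speaker⊆C false = B⊆C

  open Consistent

  Consistent-resp : ∀ {K K'} → (∀ ω → K ω ≡ K' ω) → Consistent K → Consistent K'
  Consistent-resp K≡K' κ = record
    { A-part = IsPartition-resp A≡ (A-part κ)
    ; B-part = IsPartition-resp B≡ (B-part κ)
    ; C-part = IsPartition-resp C≡ (C-part κ)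
    ; A⊆C    = Refines-resp A≡ C≡ (A⊆C κ)
    ; B⊆C    = Refines-resp B≡ C≡ (B⊆C κ)
    }
    where
    A≡ = λ ω → cong proj₁ (K≡K' ω)
    B≡ = λ ω → cong (proj₁ ∘ proj₂) (K≡K' ω)
    C≡ = λ ω → cong (proj₂ ∘ proj₂) (K≡K' ω)

  update-consistent : ∀ {K} → Consistent K → ∀ b {m} → Measurable (speaker b K) m → Consistent (update b m K)
  update-consistent {K} κ true {m} m-meas = record
    { A-part = A-part κ
    ; B-part = learn-isPartition m (B-part κ)
    ; C-part = learn-isPartition m (C-part κ)
    ; A⊆C    = refines-learn m {knowA K} (A⊆C κ) m-meas
    ; B⊆C    = learn-mono m {knowB K} (B⊆C κ)
    }
  update-consistent {K} κ false {m} m-meas = record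
    { A-part = learn-isPartition m (A-part κ)
    ; B-part = B-part κ
    ; C-part = learn-isPartition m (C-part κ)
    ; A⊆C    = learn-mono m {knowA K} (A⊆C κ)
    ; B⊆C    = refines-learn m {knowB K} (B⊆C κ) m-meas
    }

  knowC-update : ∀ b m (K : Knowledge n) ω → knowC (update b m K) ω ≡ learn (knowC K) m ω
  knowC-update true  m K ω = refl
  knowC-update false m K ω = refl

aliceTurn-suc : ∀ t → aliceTurn (suc t) ≡ not (aliceTurn t)
aliceTurn-suc zero          = refl
aliceTurn-suc (suc zero)    = refl
aliceTurn-suc (suc (suc t)) = aliceTurn-suc t

aliceTurn-even : ∀ k → aliceTurn (2 ℕ.* k) ≡ true
aliceTurn-even zero    = refl
aliceTurn-even (suc k) = subst (λ t → aliceTurn t ≡ true) (sym (ℕ.*-suc 2 k)) (aliceTurn-even k)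

module Run (n : ℕ) (D f : Fin n → ℚ) (pA pB : Partition n) (ε : ℚ) where

  open Protocol n D f pA pB ε public
  open Expectation D using (E[_∣_]; condExp-measurable)
  open Consistent

  know-suc : ∀ t ω → know (suc t) ω ≡ update (aliceTurn t) (msg t) (know t) ω
  know-suc t ω = split-turn msg refl
    where
    -- `msg t` mentions `aliceTurn t` itself, so it is kept abstract while splitting on the turn.
    split-turn : ∀ m → m ≡ msg → know (suc t) ω ≡ update (aliceTurn t) (m t) (know t) ω
    split-turn m m≡msg with aliceTurn t
    ... | true  rewrite m≡msg = refl
    ... | false rewrite m≡msg = refl

  C spk : ℕ → Fin n → Event n
  C t   = knowC (know t)
  spk t = speaker (aliceTurn t) (know t)

  msg-measurable : ∀ t → Consistent (know t) → Measurable (spk t) (msg t)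
  msg-measurable t κ ω∼ω' =
    cong₂ (discMsg ε) (condExp-measurable f (speaker-isPartition κ (aliceTurn t)) ω∼ω')
                      (condExp-measurable f (C-part κ) (speaker⊆C κ (aliceTurn t) ω∼ω'))

  consistent : ∀ t → Consistent (know t)
  consistent zero = record
    { A-part = block-isPartition pA
    ; B-part = block-isPartition pB
    ; C-part = record { own-block = λ _ → _ ; same-block = λ _ _ → refl }
    ; A⊆C    = λ _ → _
    ; B⊆C    = λ _ → _
    }
  consistent (suc t) = Consistent-resp (λ ω → sym (know-suc t ω))
    (update-consistent (consistent t) (aliceTurn t) (msg-measurable t (consistent t)))

  C-isPartition : ∀ t → IsPartition (C t)
  C-isPartition t = C-part (consistent t)

  spk-isPartition : ∀ t → IsPartition (spk t)
  spk-isPartition t = speaker-isPartition (consistent t) (aliceTurn t)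

  C-suc : ∀ t ω → C (suc t) ω ≡ learn (C t) (msg t) ω
  C-suc t ω = trans (cong (proj₂ ∘ proj₂) (know-suc t ω)) (knowC-update (aliceTurn t) (msg t) (know t) ω)

  C-suc⊆C : ∀ t → Refines (C (suc t)) (C t)
  C-suc⊆C t = Refines-resp {Q = learn (C t) (msg t)} (sym ∘ C-suc t) (λ _ → refl)
                           (learn-refines-self {R = C t} (msg t))

  msg-spk-measurable : ∀ t → Measurable (spk t) (msg t)
  msg-spk-measurable t = msg-measurable t (consistent t)

  msg-C-suc-measurable : ∀ t → Measurable (C (suc t)) (msg t)
  msg-C-suc-measurable t {ω} {ω'} ω∼ω' =
    learn-measurable {R = C t} (msg t) (subst (λ S → T (S ω')) (C-suc t ω) ω∼ω')

  A-after-alice : ∀ {t} → aliceTurn t ≡ true → ∀ ω → knowA (know (suc t)) ω ≡ spk t ω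
  A-after-alice {t} alice ω = begin
    knowA (know (suc t)) ω
      ≡⟨ cong proj₁ (know-suc t ω) ⟩
    knowA (update (aliceTurn t) (msg t) (know t)) ω
      ≡⟨ cong (λ b → knowA (update b (msg t) (know t)) ω) alice ⟩
    knowA (know t) ω
      ≡⟨ cong (λ b → speaker b (know t) ω) alice ⟨
    spk t ω ∎
    where open ≡-Reasoning

  B-bob : ∀ {t} → aliceTurn t ≡ false → ∀ ω → knowB (know t) ω ≡ spk t ω
  B-bob {t} bob ω = cong (λ b → speaker b (know t) ω) (sym bob)

module Convergence (n : ℕ) (D f : Fin n → ℚ) (pA pB : Partition n) (ε : ℚ)
                   (D>0 : ∀ ω → 0ℚ < D ω) (0≤ε : 0ℚ ≤ ε) where

  open Run n D f pA pB ε public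
  open Expectation D
  open FullSupport D>0

  a : ℚ
  a = ε * quarter

  0≤a : 0ℚ ≤ a
  0≤a = 0≤p*q 0≤ε (nonNegative⁻¹ quarter)

  EC jump s : ℕ → Fin n → ℚ
  EC t ω   = E[ f ∣ C t ω ]
  jump t ω = EC (suc t) ω - EC t ω
  s t ω    = sgn (msg t ω)

  Φ : ℕ → ℚ
  Φ t = 𝔼 (λ ω → EC t ω * EC t ω)

  Dis : ℕ → Fin n → Bool
  Dis t ω = does (ε <? ∣ EA t ω - EB t ω ∣)

  Φ-increment : ∀ t → 𝔼 (λ ω → jump t ω * jump t ω) ≡ Φ (suc t) - Φ t
  Φ-increment t = pythagoras f (C-isPartition (suc t)) (C-isPartition t) (C-suc⊆C t)

  Φ-mono : ∀ t → Φ t ≤ Φ (suc t)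
  Φ-mono t = ≤-by-diff (sym (Φ-increment t)) (𝔼-nonNeg (λ ω → 0≤p*p (jump t ω)))

  message-gain : ∀ t → a * a * 𝔼 (λ ω → s t ω * s t ω) ≤ Φ (suc t) - Φ t
  message-gain t = subst (a * a * 𝔼 (λ ω → s t ω * s t ω) ≤_) (Φ-increment t)
    (information-gain f {spk t} {C t} {C (suc t)} {s t} {a}
      (spk-isPartition t) (C-isPartition t) (C-isPartition (suc t))
      (λ ω∼ω' → cong sgn (msg-spk-measurable t ω∼ω')) (λ ω∼ω' → cong sgn (msg-C-suc-measurable t ω∼ω'))
      0≤a (λ ω → discMsg-sgn ε E[ f ∣ spk t ω ] (EC t ω)))

  charlie-moved : ∀ {t} → aliceTurn t ≡ true → ∀ ω → msg t ω ≡ medium → msg (suc t) ω ≡ medium →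
                  a * a * 𝟙 (Dis (suc t) ω) ≤ jump t ω * jump t ω
  charlie-moved {t} alice ω quiet quiet′ =
    𝟙-does-≤ (ε <? ∣ EA (suc t) ω - EB (suc t) ω ∣) (0≤p*p (jump t ω))
      (a≤∣x∣⇒a*a≤x*x {x = jump t ω} 0≤a ∘
        triangle-separation {ε} {EA (suc t) ω} {EB (suc t) ω} {EC t ω} {EC (suc t) ω} eA≈EC eB≈EC′)
    where
    bob : aliceTurn (suc t) ≡ false
    bob = trans (aliceTurn-suc t) (cong not alice)
    eA≈EC : ∣ EA (suc t) ω - EC t ω ∣ ≤ a
    eA≈EC = subst (λ e → ∣ e - EC t ω ∣ ≤ a) (cong E[ f ∣_] (sym (A-after-alice {t} alice ω)))
                  (discMsg-medium ε E[ f ∣ spk t ω ] (EC t ω) quiet)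
    eB≈EC′ : ∣ EB (suc t) ω - EC (suc t) ω ∣ ≤ a
    eB≈EC′ = subst (λ e → ∣ e - EC (suc t) ω ∣ ≤ a) (cong E[ f ∣_] (sym (B-bob {suc t} bob ω)))
                   (discMsg-medium ε E[ f ∣ spk (suc t) ω ] (EC (suc t) ω) quiet′)

  disagreement-bound : ∀ {t} → aliceTurn t ≡ true → ∀ ω →
    a * a * 𝟙 (Dis (suc t) ω)
      ≤ a * a * (s t ω * s t ω) + a * a * (s (suc t) ω * s (suc t) ω) + jump t ω * jump t ω
  disagreement-bound {t} alice ω = by-loudness (sgn²-cases (msg t ω)) (sgn²-cases (msg (suc t) ω))
    where
    0≤P : ∀ t → 0ℚ ≤ a * a * (s t ω * s t ω)
    0≤P t = 0≤p*q (0≤p*p a) (0≤p*p (s t ω))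
    a*a*𝟙≤ : ∀ {x} → x ≡ 1ℚ → a * a * 𝟙 (Dis (suc t) ω) ≤ a * a * x
    a*a*𝟙≤ x≡1 = subst (λ x → _ ≤ a * a * x) (sym x≡1)
                   (*-monoˡ-≤-nonNeg (a * a) {{nonNegative (0≤p*p a)}} (𝟙≤1 (Dis (suc t) ω)))
    by-loudness : msg t ω ≡ medium ⊎ s t ω * s t ω ≡ 1ℚ →
                  msg (suc t) ω ≡ medium ⊎ s (suc t) ω * s (suc t) ω ≡ 1ℚ →
      a * a * 𝟙 (Dis (suc t) ω)
        ≤ a * a * (s t ω * s t ω) + a * a * (s (suc t) ω * s (suc t) ω) + jump t ω * jump t ω
    by-loudness (inj₂ loud) _ =
      ≤-trans (≤-trans (a*a*𝟙≤ loud) (p≤p+q (0≤P (suc t)))) (p≤p+q (0≤p*p (jump t ω)))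
    by-loudness (inj₁ _) (inj₂ loud′) =
      ≤-trans (≤-trans (a*a*𝟙≤ loud′) (q≤p+q (0≤P t))) (p≤p+q (0≤p*p (jump t ω)))
    by-loudness (inj₁ quiet) (inj₁ quiet′) =
      ≤-trans (charlie-moved {t} alice ω quiet quiet′) (q≤p+q (+-mono-≤ (0≤P t) (0≤P (suc t))))

  round-gain : ∀ {t} → aliceTurn t ≡ true → a * a * Pr n D (Dis (suc t)) * ½ ≤ Φ (suc (suc t)) - Φ t
  -- The indicator is paid for by the gains of both messages and by Charlie's jump at t, so the
  -- increment Φ (t+1) - Φ t is counted twice; hence the factor ½.
  round-gain {t} alice = begin
    a * a * Pr n D (Dis (suc t)) * ½
      ≡⟨ cong (λ p → a * a * p * ½) (Pr≡𝔼𝟙 (Dis (suc t))) ⟩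
    a * a * 𝔼 (𝟙 ∘ Dis (suc t)) * ½
      ≡⟨ cong (_* ½) (𝔼-* (a * a) (𝟙 ∘ Dis (suc t))) ⟨
    𝔼 (λ ω → a * a * 𝟙 (Dis (suc t) ω)) * ½
      ≤⟨ *-monoʳ-≤-nonNeg ½ (𝔼-mono-≤ (disagreement-bound {t} alice)) ⟩
    𝔼 (λ ω → a * a * ss t ω + a * a * ss (suc t) ω + jump² ω) * ½
      ≡⟨ cong (_* ½) linearity ⟩
    (a * a * 𝔼 (ss t) + a * a * 𝔼 (ss (suc t)) + 𝔼 jump²) * ½
      ≤⟨ *-monoʳ-≤-nonNeg ½ (+-mono-≤ (+-mono-≤ (message-gain t) (message-gain (suc t)))
                                      (≤-reflexive (Φ-increment t))) ⟩
    ((Φ (suc t) - Φ t) + (Φ (suc (suc t)) - Φ (suc t)) + (Φ (suc t) - Φ t)) * ½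
      ≤⟨ ≤-by-diff (halve (Φ t) (Φ (suc t)) (Φ (suc (suc t))))
                   (0≤p*q (p≤q⇒0≤q-p (Φ-mono (suc t))) (nonNegative⁻¹ ½)) ⟩
    Φ (suc (suc t)) - Φ t ∎
    where
    open ≤-Reasoning
    ss : ℕ → Fin n → ℚ
    ss t ω = s t ω * s t ω
    jump² : Fin n → ℚ
    jump² ω = jump t ω * jump t ω
    linearity : 𝔼 (λ ω → a * a * ss t ω + a * a * ss (suc t) ω + jump² ω)
              ≡ a * a * 𝔼 (ss t) + a * a * 𝔼 (ss (suc t)) + 𝔼 jump²
    linearity = trans (𝔼-+ _ jump²) (cong (_+ 𝔼 jump²)
                  (trans (𝔼-+ _ _) (cong₂ _+_ (𝔼-* (a * a) (ss t)) (𝔼-* (a * a) (ss (suc t))))))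
    halve : ∀ φ₀ φ₁ φ₂ → (φ₂ - φ₀) - ((φ₁ - φ₀) + (φ₂ - φ₁) + (φ₁ - φ₀)) * ½ ≡ (φ₂ - φ₁) * ½
    halve = solve 3 (λ φ₀ φ₁ φ₂ → (φ₂ :- φ₀) :- ((φ₁ :- φ₀) :+ (φ₂ :- φ₁) :+ (φ₁ :- φ₀)) :* con ½
                                  := (φ₂ :- φ₁) :* con ½)
                    refl

  module _ (δ : ℚ) where

    y : ℚ
    y = a * a * δ * ½

    agreement-or-growth : ∀ m → (∃[ k ] (+ k / 1 * y ≤ Φ (2 ℕ.* k) × Agree δ (suc (2 ℕ.* k))))
                     ⊎ (+ m / 1 * y ≤ Φ (2 ℕ.* m))
    agreement-or-growth zero = inj₂ (subst (_≤ Φ 0) (sym (*-zeroˡ y)) (𝔼-nonNeg (λ ω → 0≤p*p (EC 0 ω))))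
    agreement-or-growth (suc m) with agreement-or-growth m
    ... | inj₁ found = inj₁ found
    ... | inj₂ my≤Φ with Pr n D (Dis (suc (2 ℕ.* m))) ≤? δ
    ...   | yes agreed   = inj₁ (m , my≤Φ , agreed)
    ...   | no disagreed = inj₂ (begin
      + suc m / 1 * y                 ≡⟨ cong (_* y) (/1-homo-+ 1 m) ⟩
      (1ℚ + + m / 1) * y              ≡⟨ distrib (+ m / 1) y ⟩
      + m / 1 * y + y                 ≤⟨ +-mono-≤ my≤Φ y≤gain ⟩
      Φ t + (Φ (suc (suc t)) - Φ t)   ≡⟨ telescope (Φ t) (Φ (suc (suc t))) ⟩
      Φ (suc (suc t))                 ≡⟨ cong Φ (ℕ.*-suc 2 m) ⟨
      Φ (2 ℕ.* suc m)                 ∎)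
      where
      open ≤-Reasoning
      t = 2 ℕ.* m
      distrib : ∀ i y → (1ℚ + i) * y ≡ i * y + y
      distrib = solve 2 (λ i y → (con 1ℚ :+ i) :* y := i :* y :+ y) refl
      telescope : ∀ φ φ′ → φ + (φ′ - φ) ≡ φ′
      telescope = solve 2 (λ φ φ′ → φ :+ (φ′ :- φ) := φ′) refl
      y≤gain : y ≤ Φ (suc (suc t)) - Φ t
      y≤gain = ≤-trans
        (*-monoʳ-≤-nonNeg ½ (*-monoˡ-≤-nonNeg (a * a) {{nonNegative (0≤p*p a)}} (<⇒≤ (≰⇒> disagreed))))
        (round-gain {t} (aliceTurn-even m))

  module _ (0≤f : ∀ ω → 0ℚ ≤ f ω) (f≤1 : ∀ ω → f ω ≤ 1ℚ) where

    Φ≤1 : Σ[Ω] n D ≡ 1ℚ → ∀ t → Φ t ≤ 1ℚ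
    Φ≤1 ΣD≡1 t = subst (Φ t ≤_) ΣD≡1 (𝔼≤Σ[Ω]D λ ω →
      let 0≤e , e≤1 = condExp-bounds 0≤f f≤1 (C t ω) in p*q≤1 0≤e e≤1 0≤e e≤1)

    agree-if-1≤ε : 1ℚ ≤ ε → ∀ {δ} → 0ℚ ≤ δ → ∀ t → Agree δ t
    agree-if-1≤ε 1≤ε 0≤δ t = ≤-trans Pr≤0 0≤δ
      where
      open ≤-Reasoning
      never : ∀ ω → 𝟙 (Dis t ω) ≤ 0ℚ
      never ω = subst (_≤ 0ℚ) (*-identityˡ _) (𝟙-does-≤ (ε <? ∣ EA t ω - EB t ω ∣) {1ℚ} ≤-refl
        (λ apart → contradiction (<-≤-trans apart (≤-trans ∣EA-EB∣≤1 1≤ε)) (<-irrefl refl)))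
        where
        ∣EA-EB∣≤1 : ∣ EA t ω - EB t ω ∣ ≤ 1ℚ
        ∣EA-EB∣≤1 = let 0≤u , u≤1 = condExp-bounds 0≤f f≤1 (knowA (know t) ω)
                        0≤v , v≤1 = condExp-bounds 0≤f f≤1 (knowB (know t) ω)
                    in ∣p-q∣≤1 0≤u u≤1 0≤v v≤1
      Pr≤0 : Pr n D (Dis t) ≤ 0ℚ
      Pr≤0 = begin
        Pr n D (Dis t)     ≡⟨ Pr≡𝔼𝟙 (Dis t) ⟩
        𝔼 (𝟙 ∘ Dis t)      ≤⟨ 𝔼-mono-≤ never ⟩
        𝔼 (λ _ → 0ℚ)       ≡⟨ 𝔼-zero ⟩
        0ℚ                 ∎

  agree-if-1≤δ : Σ[Ω] n D ≡ 1ℚ → ∀ {δ} → 1ℚ ≤ δ → ∀ t → Agree δ t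
  agree-if-1≤δ ΣD≡1 1≤δ t = ≤-trans (subst (Pr n D (Dis t) ≤_) ΣD≡1 Pr≤Σ[Ω]D) 1≤δ
    where
    Pr≤Σ[Ω]D : Pr n D (Dis t) ≤ Σ[Ω] n D
    Pr≤Σ[Ω]D = subst (_≤ Σ[Ω] n D) (sym (Pr≡𝔼𝟙 (Dis t))) (𝔼≤Σ[Ω]D (λ ω → 𝟙≤1 (Dis t ω)))

/1-odd : ∀ k → + suc (2 ℕ.* k) / 1 ≡ 1ℚ + (+ k / 1 + + k / 1)
/1-odd k = begin
  + (1 ℕ.+ (k ℕ.+ (k ℕ.+ 0))) / 1       ≡⟨ /1-homo-+ 1 (k ℕ.+ (k ℕ.+ 0)) ⟩
  1ℚ + + (k ℕ.+ (k ℕ.+ 0)) / 1          ≡⟨ cong (_+_ 1ℚ) (/1-homo-+ k (k ℕ.+ 0)) ⟩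
  1ℚ + (+ k / 1 + + (k ℕ.+ 0) / 1)      ≡⟨ cong (λ j → 1ℚ + (+ k / 1 + + j / 1)) (ℕ.+-identityʳ k) ⟩
  1ℚ + (+ k / 1 + + k / 1)              ∎
  where open ≡-Reasoning

time-bound : ∀ {k δ ε} → δ * (ε * ε) ≤ 1ℚ → + k / 1 * (ε * quarter * (ε * quarter) * δ * ½) ≤ 1ℚ →
             + suc (2 ℕ.* k) / 1 * (δ * (ε * ε)) ≤ + 65 / 1
time-bound {k} {δ} {ε} x≤1 ky≤1 = begin
  + suc (2 ℕ.* k) / 1 * x                           ≡⟨ cong (_* x) (/1-odd k) ⟩
  (1ℚ + (+ k / 1 + + k / 1)) * x                    ≡⟨ rescale (+ k / 1) δ ε ⟩
  x + + 64 / 1 * (+ k / 1 * y)                      ≤⟨ +-mono-≤ x≤1 (*-monoˡ-≤-nonNeg (+ 64 / 1) ky≤1) ⟩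
  1ℚ + + 64 / 1 * 1ℚ                                ≡⟨⟩
  + 65 / 1                                          ∎
  where
  open ≤-Reasoning
  x = δ * (ε * ε)
  y = ε * quarter * (ε * quarter) * δ * ½
  rescale : ∀ i δ ε → (1ℚ + (i + i)) * (δ * (ε * ε))
                    ≡ δ * (ε * ε) + + 64 / 1 * (i * (ε * quarter * (ε * quarter) * δ * ½))
  rescale = solve 3 (λ i δ ε → (con 1ℚ :+ (i :+ i)) :* (δ :* (ε :* ε))
                      := δ :* (ε :* ε) :+ con (+ 64 / 1) :* (i :* (ε :* con quarter :* (ε :* con quarter) :* δ :* con ½)))
                    refl

agreement-within : ∀ n (D f : Fin n → ℚ) (pA pB : Partition n) (ε δ : ℚ)
  → (∀ ω → 0ℚ < D ω) → Σ[Ω] n D ≡ 1ℚ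
  → (∀ ω → 0ℚ ≤ f ω) → (∀ ω → f ω ≤ 1ℚ)
  → 0ℚ < ε → 0ℚ < δ
  → ∃[ t ] (+ t / 1 * (δ * (ε * ε)) ≤ + 65 / 1 × Protocol.Agree n D f pA pB ε δ t)
agreement-within n D f pA pB ε δ D>0 ΣD≡1 0≤f f≤1 0<ε 0<δ = by-regime (1ℚ ≤? δ) (1ℚ ≤? ε)
  where
  open Convergence n D f pA pB ε D>0 (<⇒≤ 0<ε)
  x = δ * (ε * ε)

  immediate : + 0 / 1 * x ≤ + 65 / 1
  immediate = subst (_≤ + 65 / 1) (sym (*-zeroˡ x)) (nonNegative⁻¹ (+ 65 / 1))

  0<y : 0ℚ < y δ
  0<y = 0<p*q (0<p*q (0<p*q 0<a 0<a) 0<δ) (positive⁻¹ ½)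
    where 0<a = 0<p*q 0<ε (positive⁻¹ quarter)

  by-regime : Dec (1ℚ ≤ δ) → Dec (1ℚ ≤ ε) → ∃[ t ] (+ t / 1 * x ≤ + 65 / 1 × Agree δ t)
  by-regime (yes 1≤δ) _         = 0 , immediate , agree-if-1≤δ ΣD≡1 1≤δ 0
  by-regime (no _)    (yes 1≤ε) = 0 , immediate , agree-if-1≤ε 0≤f f≤1 1≤ε (<⇒≤ 0<δ) 0
  by-regime (no δ≱1)  (no ε≱1)  with archimedean (y δ) 0<y
  ... | M , 1<My with agreement-or-growth δ M
  ...   | inj₁ (k , ky≤Φ , agreed) =
    suc (2 ℕ.* k) , time-bound {k} {δ} {ε} x≤1 (≤-trans ky≤Φ (Φ≤1 0≤f f≤1 ΣD≡1 (2 ℕ.* k))) , agreed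
    where
    δ≤1 = <⇒≤ (≰⇒> δ≱1)
    ε≤1 = <⇒≤ (≰⇒> ε≱1)
    x≤1 : x ≤ 1ℚ
    x≤1 = p*q≤1 (<⇒≤ 0<δ) δ≤1 (0≤p*p ε) (p*q≤1 (<⇒≤ 0<ε) ε≤1 (<⇒≤ 0<ε) ε≤1)
  ...   | inj₂ My≤Φ =
    contradiction (<-≤-trans 1<My (≤-trans My≤Φ (Φ≤1 0≤f f≤1 ΣD≡1 (2 ℕ.* M)))) (<-irrefl refl)

theorem6 : ∃[ C ] ((n : ℕ) (D : Fin n → ℚ) (f : Fin n → ℚ) (pA pB : Partition n) (ε δ : ℚ)
             → (∀ ω → 0ℚ < D ω) → Σ[Ω] n D ≡ 1ℚ
             → (∀ ω → 0ℚ ≤ f ω) → (∀ ω → f ω ≤ 1ℚ)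
             → 0ℚ < ε → 0ℚ < δ
             → ∃[ t ] (((+ t / 1) * (δ * (ε * ε)) ≤ (+ C / 1))
                       × Protocol.Agree n D f pA pB ε δ t))
theorem6 = 65 , agreement-within
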